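{- A $\lambda$-term $M$ is in $\mathsf v$-normal form (i.e. there is no $N$ with $M\to_{\mathsf v}N$) if and only if $M$ is a $G$-term generated by the grammar (for $k\ge0$): $G::=H\mid R$; $H::=x\mid\lambda x.G\mid xHG_1\cdots G_k$; $R::=(\lambda x.G)(yHG_1\cdots G_k)$.
   Context: $\Lambda$ is the set of $\lambda$-terms $M::=x\mid\lambda x.M\mid MN$ up to $\alpha$-conversion (application associates to the left); values are variables and abstractions. Reductions: $(\beta_v)$ $(\lambda x.M)V\to M\{V/x\}$ for $V$ a value; $(\sigma_1)$ $(\lambda x.M)NP\to(\lambda x.MP)N$ if $x\notin FV(P)$; $(\sigma_3)$ $V((\lambda x.M)N)\to(\lambda x.VM)N$ if $V$ value, $x\notin FV(V)$. $\to_{\mathsf v}$ is the contextual closure of the union of these rules. -}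

module Defs where

open import Data.Nat using (ℕ; zero; suc)
open import Data.Fin using (Fin; zero; suc)
open import Data.Product using (Σ)
open import Relation.Nullary using (¬_)

-- λ-terms up to α-conversion: well-scoped de Bruijn terms with n free variables.
data Tm (n : ℕ) : Set where
  var : Fin n → Tm n
  lam : Tm (suc n) → Tm n
  app : Tm n → Tm n → Tm n

data Value {n : ℕ} : Tm n → Set where
  v-var : (x : Fin n) → Value (var x)
  v-lam : (M : Tm (suc n)) → Value (lam M)

ext : {n m : ℕ} → (Fin n → Fin m) → Fin (suc n) → Fin (suc m)
ext ρ zero    = zero
ext ρ (suc x) = suc (ρ x)

rename : {n m : ℕ} → (Fin n → Fin m) → Tm n → Tm m
rename ρ (var x)   = var (ρ x)
rename ρ (lam M)   = lam (rename (ext ρ) M)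
rename ρ (app M N) = app (rename ρ M) (rename ρ N)

weaken : {n : ℕ} → Tm n → Tm (suc n)
weaken = rename suc

exts : {n m : ℕ} → (Fin n → Tm m) → Fin (suc n) → Tm (suc m)
exts σ zero    = var zero
exts σ (suc x) = weaken (σ x)

subst : {n m : ℕ} → (Fin n → Tm m) → Tm n → Tm m
subst σ (var x)   = σ x
subst σ (lam M)   = lam (subst (exts σ) M)
subst σ (app M N) = app (subst σ M) (subst σ N)

-- M{V/x} where x is the outermost bound variable (index 0)
subst-zero : {n : ℕ} → Tm n → Fin (suc n) → Tm n
subst-zero V zero    = V
subst-zero V (suc x) = var x

_[_] : {n : ℕ} → Tm (suc n) → Tm n → Tm n
M [ V ] = subst (subst-zero V) M

-- →v : contextual closure of βv ∪ σ1 ∪ σ3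
-- (side conditions x ∉ FV(P), x ∉ FV(V) are realised by weakening P, V under the binder)
infix 4 _⟶v_
data _⟶v_ {n : ℕ} : Tm n → Tm n → Set where
  βv   : (M : Tm (suc n)) (V : Tm n) → Value V →
         app (lam M) V ⟶v M [ V ]
  σ₁   : (M : Tm (suc n)) (N P : Tm n) →
         app (app (lam M) N) P ⟶v app (lam (app M (weaken P))) N
  σ₃   : (V : Tm n) (M : Tm (suc n)) (N : Tm n) → Value V →
         app V (app (lam M) N) ⟶v app (lam (app (weaken V) M)) N
  ξ-lam  : {M M' : Tm (suc n)} → M ⟶v M' → lam M ⟶v lam M'
  ξ-appˡ : {M M' N : Tm n} → M ⟶v M' → app M N ⟶v app M' N
  ξ-appʳ : {M N N' : Tm n} → N ⟶v N' → app M N ⟶v app M N'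

-- the grammar  G ::= H | R ;  H ::= x | λx.G | x H G₁⋯Gₖ ;  R ::= (λx.G)(y H G₁⋯Gₖ)
-- IsSpine M  means  M = x H G₁ ⋯ Gₖ  for some variable x and k ≥ 0.
data IsG     {n : ℕ} : Tm n → Set
data IsH     {n : ℕ} : Tm n → Set
data IsR     {n : ℕ} : Tm n → Set
data IsSpine {n : ℕ} : Tm n → Set

data IsG {n} where
  g-H : {M : Tm n} → IsH M → IsG M
  g-R : {M : Tm n} → IsR M → IsG M

data IsH {n} where
  h-var   : (x : Fin n) → IsH (var x)
  h-lam   : {M : Tm (suc n)} → IsG M → IsH (lam M)
  h-spine : {M : Tm n} → IsSpine M → IsH M

data IsSpine {n} where
  sp-base : (x : Fin n) {H : Tm n} → IsH H → IsSpine (app (var x) H)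
  sp-step : {M N : Tm n} → IsSpine M → IsG N → IsSpine (app M N)

data IsR {n} where
  r-redex : {M : Tm (suc n)} {N : Tm n} → IsG M → IsSpine N → IsR (app (lam M) N)

NormalV : {n : ℕ} → Tm n → Set
NormalV {n} M = ¬ (Σ (Tm n) (λ N → M ⟶v N))

module Submission where

-- A spine x H G₁ ⋯ Gₖ has a variable as head, so it is neither a value nor an
-- application of an abstraction; this rules out βv, σ₁ and σ₃ at the root of every
-- G-term, and irreducibility of G-terms follows by induction on the grammar.
-- Conversely, by induction on a normal term M its immediate subterms are G-terms,
-- and in each way an application of two G-terms can fail to be a G-term it
-- contains a βv-, σ₁- or σ₃-redex at the root.

open import Defs
open import Data.Nat using (ℕ; suc)
open import Data.Product using (_,_)
open import Data.Empty using (⊥; ⊥-elim)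
open import Function.Bundles using (_⇔_; mk⇔)

spine-¬value : {n : ℕ} {M : Tm n} → IsSpine M → Value M → ⊥
spine-¬value () (v-var _)
spine-¬value () (v-lam _)

spine-¬lam-head : {n : ℕ} {M : Tm (suc n)} {N : Tm n} → IsSpine (app (lam M) N) → ⊥
spine-¬lam-head (sp-step () _)

H-¬redex : {n : ℕ} {M : Tm (suc n)} {N : Tm n} → IsH (app (lam M) N) → ⊥
H-¬redex (h-spine s) = spine-¬lam-head s

G-irreducible     : {n : ℕ} {M N : Tm n} → IsG M → M ⟶v N → ⊥
H-irreducible     : {n : ℕ} {M N : Tm n} → IsH M → M ⟶v N → ⊥
R-irreducible     : {n : ℕ} {M N : Tm n} → IsR M → M ⟶v N → ⊥
spine-irreducible : {n : ℕ} {M N : Tm n} → IsSpine M → M ⟶v N → ⊥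

G-irreducible (g-H h) r = H-irreducible h r
G-irreducible (g-R x) r = R-irreducible x r

H-irreducible (h-var _)   ()
H-irreducible (h-lam g)   (ξ-lam r) = G-irreducible g r
H-irreducible (h-spine s) r         = spine-irreducible s r

R-irreducible (r-redex g s) (βv _ _ v)          = spine-¬value s v
R-irreducible (r-redex g s) (σ₃ _ _ _ _)        = spine-¬lam-head s
R-irreducible (r-redex g s) (ξ-appˡ (ξ-lam r))  = G-irreducible g r
R-irreducible (r-redex g s) (ξ-appʳ r)          = spine-irreducible s r

spine-irreducible (sp-base _ h) (σ₃ _ _ _ _) = H-¬redex h
spine-irreducible (sp-base _ h) (ξ-appʳ r)   = H-irreducible h r
spine-irreducible (sp-step s g) (σ₁ _ _ _)   = spine-¬lam-head s
spine-irreducible (sp-step s g) (σ₃ _ _ _ v) = spine-¬value s v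
spine-irreducible (sp-step s g) (ξ-appˡ r)   = spine-irreducible s r
spine-irreducible (sp-step s g) (ξ-appʳ r)   = G-irreducible g r

G⇒NormalV : {n : ℕ} {M : Tm n} → IsG M → NormalV M
G⇒NormalV g (_ , r) = G-irreducible g r

NormalV-lam⁻ : {n : ℕ} {M : Tm (suc n)} → NormalV (lam M) → NormalV M
NormalV-lam⁻ nf (M' , r) = nf (lam M' , ξ-lam r)

NormalV-appˡ : {n : ℕ} {M N : Tm n} → NormalV (app M N) → NormalV M
NormalV-appˡ {N = N} nf (M' , r) = nf (app M' N , ξ-appˡ r)

NormalV-appʳ : {n : ℕ} {M N : Tm n} → NormalV (app M N) → NormalV N
NormalV-appʳ {M = M} nf (N' , r) = nf (app M N' , ξ-appʳ r)

NormalV-app⇒G : {n : ℕ} {M N : Tm n} →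
                NormalV (app M N) → IsG M → IsG N → IsG (app M N)
NormalV-app⇒G nf (g-R (r-redex {M} {N} _ _)) _ = ⊥-elim (nf (_ , σ₁ M N _))
NormalV-app⇒G nf (g-H (h-spine s)) gN          = g-H (h-spine (sp-step s gN))
NormalV-app⇒G nf (g-H (h-var x)) (g-H h)       = g-H (h-spine (sp-base x h))
NormalV-app⇒G nf (g-H (h-var x)) (g-R (r-redex {M} {N} _ _)) =
  ⊥-elim (nf (_ , σ₃ _ M N (v-var x)))
NormalV-app⇒G nf (g-H (h-lam gM)) (g-H (h-spine s)) = g-R (r-redex gM s)
NormalV-app⇒G nf (g-H (h-lam {M} _)) (g-H (h-var y)) =
  ⊥-elim (nf (_ , βv M _ (v-var y)))
NormalV-app⇒G nf (g-H (h-lam {M} _)) (g-H (h-lam {N} _)) =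
  ⊥-elim (nf (_ , βv M _ (v-lam N)))
NormalV-app⇒G nf (g-H (h-lam {P} _)) (g-R (r-redex {M} {N} _ _)) =
  ⊥-elim (nf (_ , σ₃ _ M N (v-lam P)))

NormalV⇒G : {n : ℕ} (M : Tm n) → NormalV M → IsG M
NormalV⇒G (var x)   nf = g-H (h-var x)
NormalV⇒G (lam M)   nf = g-H (h-lam (NormalV⇒G M (NormalV-lam⁻ nf)))
NormalV⇒G (app M N) nf = NormalV-app⇒G nf (NormalV⇒G M (NormalV-appˡ nf))
                                          (NormalV⇒G N (NormalV-appʳ nf))

lemma1p7 : {n : ℕ} (M : Tm n) → NormalV M ⇔ IsG M
lemma1p7 M = mk⇔ (NormalV⇒G M) G⇒NormalV
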